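{- For any infinite word $\mathbf x$ over a finite alphabet, $r(n,\mathbf x) \le p(n,\mathbf x) + n$ for every $n \ge 1$.
   Context: For an infinite word $\mathbf x = x_1x_2\ldots$, $x_i^j$ denotes $x_i\cdots x_j$; $p(n,\mathbf x) = \#\{x_kx_{k+1}\cdots x_{k+n-1} : k\ge 1\}$ is the number of distinct factors of length $n$ of $\mathbf x$; and $r(n,\mathbf x) = \min\{ m \ge 1 : x_i^{i+n-1} = x_{m-n+1}^{m} \text{ for some } i \text{ with } 1 \le i \le m-n\}$. -}

module Defs where

open import Data.Nat using (ℕ; suc; _+_; _∸_; _≤_; _<_)
open import Data.Fin using (Fin; toℕ)
open import Data.Vec using (Vec; tabulate)
open import Data.Product using (Σ; ∃; _×_)
open import Function.Definitions using (Injective)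
open import Relation.Binary.PropositionalEquality using (_≡_)

-- An infinite word x = x₁ x₂ … over the finite alphabet Fin k,
-- stored 0-based: (w j) is the letter x_{j+1}.
Word : ℕ → Set
Word k = ℕ → Fin k

-- x_i^{i+n-1} = x_i ⋯ x_{i+n-1}, for a 1-based position i ≥ 1.
factorAt : ∀ {k} → Word k → (i n : ℕ) → Vec (Fin k) n
factorAt w i n = tabulate (λ j → w ((i ∸ 1) + toℕ j))

IsFactor : ∀ {k} → Word k → (n : ℕ) → Vec (Fin k) n → Set
IsFactor w n u = Σ ℕ (λ t → 1 ≤ t × factorAt w t n ≡ u)

-- p(n,x) = c : the set of length-n factors of x has exactly c elements,
-- i.e. there is an injective enumeration Fin c → factors that is onto.
IsFactorCount : ∀ {k} → Word k → (n c : ℕ) → Set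
IsFactorCount {k} w n c =
  Σ (Fin c → Vec (Fin k) n) λ fs →
    Injective _≡_ _≡_ fs ×
    (∀ j → IsFactor w n (fs j)) ×
    (∀ u → IsFactor w n u → Σ (Fin c) (λ j → fs j ≡ u))

-- The defining property of r(n,x):  x_i^{i+n-1} = x_{m-n+1}^m
-- for some i with 1 ≤ i ≤ m - n.
RProp : ∀ {k} → Word k → (n m : ℕ) → Set
RProp w n m =
  Σ ℕ λ i → 1 ≤ i × i ≤ m ∸ n × factorAt w i n ≡ factorAt w (suc (m ∸ n)) n

IsR : ∀ {k} → Word k → (n m : ℕ) → Set
IsR w n m = 1 ≤ m × RProp w n m × (∀ m′ → 1 ≤ m′ → RProp w n m′ → m ≤ m′)

module Submission where

-- Among the c + 1 length-n factors of x starting at the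
-- positions 1, …, c + 1 only c are distinct (there are only c factors
-- of length n at all), so by the pigeonhole principle two of them
-- coincide: x_{i+1}^{i+n} = x_{j+1}^{j+n} with i < j ≤ c.  Reading the
-- second occurrence as a suffix ending at m = j + n shows that m
-- satisfies the defining property of r(n,x), and m ≤ c + n.  Since this
-- property is decidable (it is a bounded search over i), the least
-- number principle yields the minimum r(n,x) ≤ m ≤ c + n.

open import Defs
open import Data.Nat using (ℕ; suc; _+_; _∸_; _≤_; _<_; z≤n; s≤s; _≤?_)
open import Data.Nat.Properties
  using (anyUpTo?; ≮⇒≥; ≤-pred; ≤-refl; ≤-trans; m+n∸n≡m; m≤n+m; +-monoˡ-≤)
open import Data.Nat.Induction using (<-rec)
open import Data.Fin using (Fin; toℕ) renaming (_≟_ to _≟ᶠ_)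
open import Data.Fin.Properties using (pigeonhole; toℕ<n)
open import Data.Vec using (Vec)
open import Data.Vec.Properties using (≡-dec)
open import Data.Product using (Σ; ∃; _×_; _,_; proj₁; proj₂)
open import Relation.Nullary using (yes; no)
open import Relation.Nullary.Decidable using (map′; _×-dec_)
open import Relation.Unary using (Decidable)
open import Relation.Binary.PropositionalEquality
  using (_≡_; refl; sym; trans; cong; subst)

Least : (ℕ → Set) → ℕ → Set
Least P m = P m × (∀ m′ → P m′ → m ≤ m′)

least : {P : ℕ → Set} → Decidable P → ∀ m → P m → ∃ (Least P)
least {P} P? = <-rec (λ m → P m → ∃ (Least P)) step
  where
    step : ∀ m → (∀ {m′} → m′ < m → P m′ → ∃ (Least P)) → P m → ∃ (Least P)
    step m smaller pm with anyUpTo? P? m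
    ... | yes (m′ , m′<m , pm′) = smaller m′<m pm′
    ... | no none = m , pm , λ m′ pm′ → ≮⇒≥ (λ m′<m → none (m′ , m′<m , pm′))

rProp? : ∀ {k} (w : Word k) n → Decidable (RProp w n)
rProp? {k} w n m = map′ shift unshift
  (anyUpTo? (λ i′ → ≡-dec _≟ᶠ_ (factorAt w (suc i′) n) suffix) (m ∸ n))
  where
    suffix : Vec (Fin k) n
    suffix = factorAt w (suc (m ∸ n)) n
    shift : ∃ (λ i′ → i′ < m ∸ n × factorAt w (suc i′) n ≡ suffix) → RProp w n m
    shift (i′ , i′<m∸n , eq) = suc i′ , s≤s z≤n , i′<m∸n , eq
    unshift : RProp w n m → ∃ (λ i′ → i′ < m ∸ n × factorAt w (suc i′) n ≡ suffix)
    unshift (suc i′ , _ , i≤m∸n , eq) = i′ , i≤m∸n , eq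

RCandidate : ∀ {k} → Word k → ℕ → ℕ → Set
RCandidate w n m = 1 ≤ m × RProp w n m

least⇒IsR : ∀ {k} (w : Word k) n {r} → Least (RCandidate w n) r → IsR w n r
least⇒IsR w n ((1≤r , rprop) , minimal) =
  1≤r , rprop , λ m′ 1≤m′ rprop′ → minimal m′ (1≤m′ , rprop′)

-- A factor of length n occurring at 1-based positions i + 1 < j + 1
-- makes m = j + n a candidate: the length-n suffix of x_1^m starts at
-- position j + 1 and already occurs at position i + 1 ≤ m ∸ n.
repetition⇒candidate : ∀ {k} (w : Word k) n {i j} → 1 ≤ n → i < j →
  factorAt w (suc i) n ≡ factorAt w (suc j) n → RCandidate w n (j + n)
repetition⇒candidate w n {i} {j} 1≤n i<j eq =
  ≤-trans 1≤n (m≤n+m n j) ,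
  suc i , s≤s z≤n , subst (suc i ≤_) (sym j+n∸n≡j) i<j ,
  trans eq (cong (λ t → factorAt w (suc t) n) (sym j+n∸n≡j))
  where
    j+n∸n≡j : j + n ∸ n ≡ j
    j+n∸n≡j = m+n∸n≡m j n

coveredCollision : ∀ {A : Set} c (fs : Fin c → A) (g : Fin (suc c) → A) →
  (∀ t → Σ (Fin c) λ l → fs l ≡ g t) →
  Σ (Fin (suc c)) λ i → Σ (Fin (suc c)) λ j → toℕ i < toℕ j × g i ≡ g j
coveredCollision c fs g covered
  with i , j , i<j , sameIndex ← pigeonhole ≤-refl (λ t → proj₁ (covered t))
  = i , j , i<j ,
    trans (sym (proj₂ (covered i))) (trans (cong fs sameIndex) (proj₂ (covered j)))

earlyRepetition : ∀ {k} (w : Word k) n c → IsFactorCount w n c →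
  Σ ℕ λ i → Σ ℕ λ j → i < j × j ≤ c ×
    factorAt w (suc i) n ≡ factorAt w (suc j) n
earlyRepetition w n c (fs , _ , _ , enumerates)
  with i , j , i<j , repeated ←
         coveredCollision c fs (λ t → factorAt w (suc (toℕ t)) n)
           (λ t → enumerates _ (suc (toℕ t) , s≤s z≤n , refl))
  = toℕ i , toℕ j , i<j , ≤-pred (toℕ<n j) , repeated

lemma2p2 : (k : ℕ) (w : Word k) (n : ℕ) → 1 ≤ n →
    (c : ℕ) → IsFactorCount w n c →
    Σ ℕ (λ r → IsR w n r × r ≤ c + n)
lemma2p2 k w n 1≤n c count
  with i , j , i<j , j≤c , repeated ← earlyRepetition w n c count
  with candidate ← repetition⇒candidate w n 1≤n i<j repeated
  with r , minimal ← least (λ m → (1 ≤? m) ×-dec rProp? w n m) (j + n) candidate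
  = r , least⇒IsR w n minimal ,
    ≤-trans (proj₂ minimal (j + n) candidate) (+-monoˡ-≤ n j≤c)
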